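{- In any execution of Algorithm A, if $id\in$ timely$_p$ for some correct process $p$ (timely as computed at Step 3), then $id\in$ accepted$_q$ (as computed at the end of Step 4) for every correct process $q$.
   Context: System model: $N$ processes in a fully connected synchronous message-passing network with reliable channels; a receiver knows the label of the link on which a message arrived but not the sender's identifier; each correct process has a unique identifier initially known only to itself; up to $t$ processes are Byzantine (arbitrary behavior); throughout, $N>3t$. "Broadcast" means send to all $N$ links (including a self-loop). Id selection phase of Algorithm A (each correct process). Step 1: broadcast $\langle ID, my\_id\rangle$; Ids $:=$ set of identifiers received in ID messages. Step 2: for each $id\in$ Ids broadcast $\langle ECHO,id\rangle$; reset Ids to the set of $id$ for which $\langle ECHO,id\rangle$ was received on at least $N-t$ distinct links. Step 3: for each $id\in$ Ids broadcast $\langle READY,id\rangle$; timely $:=$ set of $id$ for which $\langle READY,id\rangle$ was received on at least $N-t$ distinct links; reset Ids to the set of $id$ for which $\langle READY,id\rangle$ was received on at least $N-2t$ distinct links and for which the process has not broadcast $\langle READY,id\rangle$. Step 4: for each $id\in$ Ids broadcast $\langle READY,id\rangle$; accepted $:=$ set of $id$ for which $\langle READY,id\rangle$ messages (Steps 3 and 4 together) were received on at least $N-t$ distinct links. -}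

module Defs where

open import Data.Nat using (ℕ; zero; suc; _+_; _*_; _∸_; _≤_; _<_; _≤ᵇ_; _≡ᵇ_)
open import Data.Bool using (Bool; true; false; if_then_else_; _∧_; _∨_; not)
open import Data.Fin using (Fin; zero; suc)
open import Relation.Binary.PropositionalEquality using (_≡_)
open import Function using (_∘_)
open import Function.Definitions using (Injective)

count : ∀ {n} → (Fin n → Bool) → ℕ
count {zero}  f = 0
count {suc n} f = (if f zero then 1 else 0) + count (f ∘ suc)

anyFin : ∀ {n} → (Fin n → Bool) → Bool
anyFin {zero}  f = false
anyFin {suc n} f = f zero ∨ anyFin (f ∘ suc)

-- Processes are Fin N (global names used only for the model, not known to
-- the processes).
record Execution (N t : ℕ) : Set where
  field
    correct    : Fin N → Bool
    faultBound : count (not ∘ correct) ≤ t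
    myid       : Fin N → ℕ
    uniqueIds  : ∀ p q → correct p ≡ true → correct q ≡ true →
                 myid p ≡ myid q → p ≡ q
    -- link l of process q leads to process (nbr q l); every process has one
    -- link to every process (including a self-loop).
    nbr        : Fin N → Fin N → Fin N
    nbr-inj    : ∀ q → Injective _≡_ _≡_ (nbr q)
    -- Byzantine behaviour: byzX p q x = true iff (faulty) p sends the
    -- message ⟨X , x⟩ to q in the corresponding step (arbitrary sets of
    -- messages, possibly different for different receivers).
    byzID      : Fin N → Fin N → ℕ → Bool
    byzECHO    : Fin N → Fin N → ℕ → Bool
    byzREADY3  : Fin N → Fin N → ℕ → Bool
    byzREADY4  : Fin N → Fin N → ℕ → Bool

module AlgorithmA {N t : ℕ} (e : Execution N t) where
  open Execution e

  sendID : Fin N → Fin N → ℕ → Bool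
  sendID p q x = if correct p then myid p ≡ᵇ x else byzID p q x

  Ids1 : Fin N → ℕ → Bool
  Ids1 q x = anyFin (λ l → sendID (nbr q l) q x)

  sendECHO : Fin N → Fin N → ℕ → Bool
  sendECHO p q x = if correct p then Ids1 p x else byzECHO p q x

  Ids2 : Fin N → ℕ → Bool
  Ids2 q x = (N ∸ t) ≤ᵇ count (λ l → sendECHO (nbr q l) q x)

  sendREADY3 : Fin N → Fin N → ℕ → Bool
  sendREADY3 p q x = if correct p then Ids2 p x else byzREADY3 p q x

  ready3count : Fin N → ℕ → ℕ
  ready3count q x = count (λ l → sendREADY3 (nbr q l) q x)

  timely : Fin N → ℕ → Bool
  timely q x = (N ∸ t) ≤ᵇ ready3count q x

  Ids3 : Fin N → ℕ → Bool
  Ids3 q x = ((N ∸ (t + t)) ≤ᵇ ready3count q x) ∧ not (Ids2 q x)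

  sendREADY4 : Fin N → Fin N → ℕ → Bool
  sendREADY4 p q x = if correct p then Ids3 p x else byzREADY4 p q x

  accepted : Fin N → ℕ → Bool
  accepted q x =
    (N ∸ t) ≤ᵇ count (λ l → sendREADY3 (nbr q l) q x ∨ sendREADY4 (nbr q l) q x)

module Submission where

-- If some process p finds x timely at Step 3, then ⟨READY,x⟩ reached p on at
-- least N∸t links, of which at most t lead to faulty processes; hence at least
-- N∸2t CORRECT processes broadcast ⟨READY,x⟩ at Step 3.  Every process has one
-- link to each process, so every correct process r receives those N∸2t READY
-- messages: either r itself broadcast ⟨READY,x⟩ at Step 3, or it passes the
-- N∸2t threshold without having done so and broadcasts it at Step 4.  Thus every
-- correct process sends ⟨READY,x⟩ to q at Step 3 or 4, and since at least N∸t
-- processes are correct, q accepts x.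

open import Defs
open import Data.Nat using (ℕ; zero; suc; _+_; _*_; _∸_; _≤_; _<_; _≤ᵇ_; z≤n; s≤s)
open import Data.Nat.Properties
open import Data.Bool using (Bool; true; false; if_then_else_; _∧_; _∨_; not)
open import Data.Bool.Properties using (T-≡)
open import Data.Fin using (Fin; zero; suc; punchIn; punchOut)
open import Data.Fin.Properties using (punchOut-injective; punchIn-punchOut)
  renaming (suc-injective to Fin-suc-injective)
open import Function using (_∘_; id)
open import Function.Bundles using (Equivalence)
open import Function.Definitions using (Injective)
open import Relation.Binary.PropositionalEquality
  using (_≡_; _≢_; refl; sym; trans; cong; subst; module ≡-Reasoning)

≤ᵇ-true : ∀ {m n} → m ≤ n → (m ≤ᵇ n) ≡ true
≤ᵇ-true m≤n = Equivalence.to T-≡ (≤⇒≤ᵇ m≤n)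

≤ᵇ-true⁻¹ : ∀ {m n} → (m ≤ᵇ n) ≡ true → m ≤ n
≤ᵇ-true⁻¹ {m} {n} eq = ≤ᵇ⇒≤ m n (Equivalence.from T-≡ eq)

b2n : Bool → ℕ
b2n b = if b then 1 else 0

count-complement : ∀ {n} (f : Fin n → Bool) → count f + count (not ∘ f) ≡ n
count-complement {zero}  f = refl
count-complement {suc n} f with f zero | count-complement (f ∘ suc)
... | true  | eq = cong suc eq
... | false | eq = trans (+-suc (count (f ∘ suc)) _) (cong suc eq)

count-punchIn : ∀ {m} (g : Fin (suc m) → Bool) (j : Fin (suc m)) →
                count g ≡ b2n (g j) + count (g ∘ punchIn j)
count-punchIn g zero = refl
count-punchIn {suc m} g (suc j) = begin
  b2n (g zero) + count (g ∘ suc)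
    ≡⟨ cong (b2n (g zero) +_) (count-punchIn (g ∘ suc) j) ⟩
  b2n (g zero) + (b2n (g (suc j)) + rest)
    ≡⟨ sym (+-assoc (b2n (g zero)) _ _) ⟩
  (b2n (g zero) + b2n (g (suc j))) + rest
    ≡⟨ cong (_+ rest) (+-comm (b2n (g zero)) (b2n (g (suc j)))) ⟩
  (b2n (g (suc j)) + b2n (g zero)) + rest
    ≡⟨ +-assoc (b2n (g (suc j))) _ _ ⟩
  b2n (g (suc j)) + (b2n (g zero) + rest) ∎
  where
  open ≡-Reasoning
  rest : ℕ
  rest = count (g ∘ suc ∘ punchIn j)

-- By induction on the
-- domain: remove 0 from the domain and π 0 from the codomain (via punchOut).
count-inj-≤ : ∀ {n m} (f : Fin n → Bool) (g : Fin m → Bool) (π : Fin n → Fin m) →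
              Injective _≡_ _≡_ π → (∀ i → f i ≡ true → g (π i) ≡ true) →
              count f ≤ count g
count-inj-≤ {zero} f g π inj h = z≤n
count-inj-≤ {suc n} {zero} f g π inj h with π zero
... | ()
count-inj-≤ {suc n} {suc m} f g π inj h =
  subst (count f ≤_) (sym (count-punchIn g (π zero))) split
  where
  avoids : ∀ i → π zero ≢ π (suc i)
  avoids i eq with inj eq
  ... | ()
  π′ : Fin n → Fin m
  π′ i = punchOut (avoids i)
  π′-inj : Injective _≡_ _≡_ π′
  π′-inj {i} {j} eq = Fin-suc-injective (inj (punchOut-injective (avoids i) (avoids j) eq))
  h′ : ∀ i → f (suc i) ≡ true → g (punchIn (π zero) (π′ i)) ≡ true
  h′ i fi = subst (λ k → g k ≡ true) (sym (punchIn-punchOut (avoids i))) (h (suc i) fi)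
  rest : count (f ∘ suc) ≤ count (g ∘ punchIn (π zero))
  rest = count-inj-≤ (f ∘ suc) (g ∘ punchIn (π zero)) π′ π′-inj h′
  split : count f ≤ b2n (g (π zero)) + count (g ∘ punchIn (π zero))
  split with f zero in f0
  ... | false = ≤-trans rest (m≤n+m _ _)
  ... | true rewrite h zero f0 = s≤s rest

count-mono : ∀ {n} (f g : Fin n → Bool) → (∀ i → f i ≡ true → g i ≡ true) →
             count f ≤ count g
count-mono f g = count-inj-≤ f g id id

-- Relabelling Fin n by an injective (hence bijective) map does not change a
-- count; the ≥ direction follows from the ≤ direction applied to the complement.
count-reindex : ∀ {n} (g : Fin n → Bool) (π : Fin n → Fin n) →
                Injective _≡_ _≡_ π → count (g ∘ π) ≡ count g
count-reindex {n} g π inj = ≤-antisym (shrink g) grow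
  where
  shrink : (h : Fin n → Bool) → count (h ∘ π) ≤ count h
  shrink h = count-inj-≤ (h ∘ π) h π inj (λ _ hi → hi)
  grow : count g ≤ count (g ∘ π)
  grow = +-cancelʳ-≤ (count (not ∘ g ∘ π)) _ _ (begin
    count g + count (not ∘ g ∘ π)  ≤⟨ +-monoʳ-≤ (count g) (shrink (not ∘ g)) ⟩
    count g + count (not ∘ g)      ≡⟨ count-complement g ⟩
    n                              ≡⟨ sym (count-complement (g ∘ π)) ⟩
    count (g ∘ π) + count (not ∘ g ∘ π) ∎)
    where open ≤-Reasoning

count-∨ : ∀ {n} (f g : Fin n → Bool) → count (λ i → f i ∨ g i) ≤ count f + count g
count-∨ {zero} f g = z≤n
count-∨ {suc n} f g with f zero | g zero | count-∨ (f ∘ suc) (g ∘ suc)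
... | true  | true  | r = s≤s (≤-trans r (+-monoʳ-≤ (count (f ∘ suc)) (n≤1+n _)))
... | true  | false | r = s≤s r
... | false | true  | r = ≤-trans (s≤s r) (≤-reflexive (sym (+-suc _ _)))
... | false | false | r = r

count-from-failures : ∀ {n t} (f : Fin n → Bool) → count (not ∘ f) ≤ t →
                      n ∸ t ≤ count f
count-from-failures {n} {t} f fails = begin
  n ∸ t                                ≤⟨ ∸-monoʳ-≤ n fails ⟩
  n ∸ count (not ∘ f)                  ≡⟨ cong (_∸ count (not ∘ f)) (sym (count-complement f)) ⟩
  count f + count (not ∘ f) ∸ count (not ∘ f) ≡⟨ m+n∸n≡m (count f) (count (not ∘ f)) ⟩
  count f ∎
  where open ≤-Reasoning

module ReadyPropagation {N t : ℕ} (e : Execution N t) (x : ℕ) where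
  open Execution e
  open AlgorithmA e

  readySender : Fin N → Bool
  readySender r = correct r ∧ Ids2 r x

  -- Any process receives ⟨READY,x⟩ at Step 3 on at least as many links as
  -- there are correct Step-3 senders, since its links reach every process.
  readySenders-received : ∀ r → count readySender ≤ ready3count r x
  readySenders-received r = begin
    count readySender            ≡⟨ sym (count-reindex readySender (nbr r) (nbr-inj r)) ⟩
    count (readySender ∘ nbr r)  ≤⟨ count-mono _ _ (λ l → fromSender (nbr r l)) ⟩
    ready3count r x ∎
    where
    open ≤-Reasoning
    fromSender : ∀ s → readySender s ≡ true → sendREADY3 s r x ≡ true
    fromSender s sent with correct s
    ... | true  = sent
    ... | false with sent
    ... | ()

  -- A timely process witnesses at least N ∸ 2t correct Step-3 senders: each
  -- link delivering READY leads to a correct sender or to one of ≤ t faulty ones.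
  timely⇒readySenders : ∀ p → timely p x ≡ true → N ∸ (t + t) ≤ count readySender
  timely⇒readySenders p timely-p = begin
    N ∸ (t + t)                      ≡⟨ sym (∸-+-assoc N t t) ⟩
    N ∸ t ∸ t                        ≤⟨ ∸-monoˡ-≤ t received ⟩
    count readySender + t ∸ t        ≡⟨ m+n∸n≡m (count readySender) t ⟩
    count readySender ∎
    where
    open ≤-Reasoning
    senderOrFaulty : Fin N → Bool
    senderOrFaulty s = readySender s ∨ not (correct s)
    classify : ∀ l → sendREADY3 (nbr p l) p x ≡ true → senderOrFaulty (nbr p l) ≡ true
    classify l sent with correct (nbr p l)
    ... | true  = subst (λ b → b ∨ false ≡ true) (sym sent) refl
    ... | false = refl
    received : N ∸ t ≤ count readySender + t
    received = begin
      N ∸ t                                       ≤⟨ ≤ᵇ-true⁻¹ timely-p ⟩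
      ready3count p x                             ≤⟨ count-inj-≤ _ _ (nbr p) (nbr-inj p) classify ⟩
      count senderOrFaulty                        ≤⟨ count-∨ readySender (not ∘ correct) ⟩
      count readySender + count (not ∘ correct)   ≤⟨ +-monoʳ-≤ (count readySender) faultBound ⟩
      count readySender + t ∎

  correct-sends-ready : ∀ r q → correct r ≡ true →
                        N ∸ (t + t) ≤ ready3count r x →
                        (sendREADY3 r q x ∨ sendREADY4 r q x) ≡ true
  correct-sends-ready r q cr enough rewrite cr with Ids2 r x
  ... | true  = refl
  ... | false rewrite ≤ᵇ-true enough = refl

lemma1 : ∀ (N t : ℕ) → 3 * t < N → (e : Execution N t) →
    ∀ (p q : Fin N) (x : ℕ) →
    Execution.correct e p ≡ true → Execution.correct e q ≡ true →
    AlgorithmA.timely e p x ≡ true → AlgorithmA.accepted e q x ≡ true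
lemma1 N t _ e p q x _ _ timely-p = ≤ᵇ-true (begin
  N ∸ t                          ≤⟨ count-from-failures correct faultBound ⟩
  count correct                  ≡⟨ sym (count-reindex correct (nbr q) (nbr-inj q)) ⟩
  count (correct ∘ nbr q)        ≤⟨ count-mono _ _ (λ l → everyCorrectSends (nbr q l)) ⟩
  count (λ l → sendREADY3 (nbr q l) q x ∨ sendREADY4 (nbr q l) q x) ∎)
  where
  open ≤-Reasoning
  open Execution e
  open AlgorithmA e
  open ReadyPropagation e x
  everyCorrectSends : ∀ r → correct r ≡ true → (sendREADY3 r q x ∨ sendREADY4 r q x) ≡ true
  everyCorrectSends r cr = correct-sends-ready r q cr
    (≤-trans (timely⇒readySenders p timely-p) (readySenders-received r))
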